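{- Let $G$ be a finite connected graph that contains neither $2P_2$ (the disjoint union of two copies of the single-edge path $P_2$) nor $\overline{P_5}$ (the complement of the path on $5$ vertices, the "house") as an induced subgraph. Then $c(G) \leq 2$.
   Context: Cops and Robber game on a finite connected graph $G$: a player controlling $k$ cops places them on vertices (not necessarily distinct), then the robber is placed on a vertex; then the cops and the robber alternately move, each piece in its turn either moving to an adjacent vertex or staying put. The cops win if after finitely many rounds some cop occupies the same vertex as the robber; both sides have complete information. The cop number $c(G)$ is the minimum number of cops that can guarantee capture of the robber on $G$. -}

module Defs where

open import Data.Nat using (ℕ; zero; suc; _+_; _≤_; _≡ᵇ_)
open import Data.Fin using (Fin; toℕ; splitAt)
open import Data.Bool using (Bool; true; false; not; _∧_; _∨_)
open import Data.Sum using (_⊎_; inj₁; inj₂)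
open import Data.Product using (Σ; _×_; ∃; ∃-syntax)
open import Relation.Binary.PropositionalEquality using (_≡_)
open import Relation.Binary.Construct.Closure.ReflexiveTransitive using (Star)
open import Function.Definitions using (Injective)

record Graph : Set where
  constructor mkGraph
  field
    n   : ℕ
    adj : Fin n → Fin n → Bool
open Graph public

V : Graph → Set
V G = Fin (n G)

Adj : (G : Graph) → V G → V G → Set
Adj G u v = adj G u v ≡ true

IsSimple : Graph → Set
IsSimple G = (∀ u v → adj G u v ≡ adj G v u) × (∀ u → adj G u u ≡ false)

Connected : Graph → Set
Connected G = (1 ≤ n G) × (∀ u v → Star (Adj G) u v)

InducedSubgraph : Graph → Graph → Set
InducedSubgraph H G =
  Σ (V H → V G) λ f → Injective _≡_ _≡_ f × (∀ i j → adj H i j ≡ adj G (f i) (f j))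

_≡ᶠ_ : ∀ {m} → Fin m → Fin m → Bool
i ≡ᶠ j = toℕ i ≡ᵇ toℕ j

Path : ℕ → Graph
Path m = mkGraph m (λ i j → (suc (toℕ i) ≡ᵇ toℕ j) ∨ (suc (toℕ j) ≡ᵇ toℕ i))

complement : Graph → Graph
complement G = mkGraph (n G) (λ i j → not (adj G i j) ∧ not (i ≡ᶠ j))

private
  unionAdj : (G H : Graph) → Fin (n G) ⊎ Fin (n H) → Fin (n G) ⊎ Fin (n H) → Bool
  unionAdj G H (inj₁ a) (inj₁ b) = adj G a b
  unionAdj G H (inj₂ a) (inj₂ b) = adj H a b
  unionAdj G H (inj₁ _) (inj₂ _) = false
  unionAdj G H (inj₂ _) (inj₁ _) = false

_⊕_ : Graph → Graph → Graph
G ⊕ H = mkGraph (n G + n H) (λ i j → unionAdj G H (splitAt (n G) i) (splitAt (n G) j))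

2P₂ : Graph
2P₂ = Path 2 ⊕ Path 2

house : Graph
house = complement (Path 5)

Contains : Graph → Graph → Set
Contains G H = InducedSubgraph H G

Step : (G : Graph) → V G → V G → Set
Step G u v = (u ≡ v) ⊎ Adj G u v

Caught : (G : Graph) {k : ℕ} → (Fin k → V G) → V G → Set
Caught G cs r = ∃[ i ] cs i ≡ r

-- CopWin G cs r : with cops at cs and robber at r, cops to move,
-- the cops can force capture in finitely many rounds.
data CopWin (G : Graph) {k : ℕ} : (Fin k → V G) → V G → Set where
  caught : ∀ {cs r} → Caught G cs r → CopWin G cs r
  move   : ∀ {cs r} (cs' : Fin k → V G) →
           (∀ i → Step G (cs i) (cs' i)) →
           (Caught G cs' r ⊎ (∀ r' → Step G r r' → CopWin G cs' r')) →
           CopWin G cs r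

CopsWin : Graph → ℕ → Set
CopsWin G k = Σ (Fin k → V G) λ cs → ∀ r → CopWin G cs r

-- c(G) ≤ m  (c(G) is the least k with CopsWin G k)
CopNumber≤ : Graph → ℕ → Set
CopNumber≤ G m = ∃[ k ] (k ≤ m × CopsWin G k)

module Submission where

open import Defs
open import Relation.Nullary using (¬_; Dec; yes; no)
open import Data.Nat.Properties using (≤-refl)
open import Data.Fin using (Fin; zero; suc; fromℕ<; _≟_)
open import Data.Fin.Properties using (all?; any?)
open import Data.Bool using (true; false)
open import Data.Bool.Properties using () renaming (_≟_ to _≟ᵇ_)
open import Data.Sum using (_⊎_; inj₁; inj₂; [_,_]′)
open import Data.Product using (_×_; _,_; proj₁; proj₂; ∃-syntax)
open import Data.Empty using (⊥; ⊥-elim)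
open import Function using (id)
open import Relation.Nullary.Decidable using (_×-dec_; _→-dec_; from-yes)
open import Relation.Binary.PropositionalEquality using (_≡_; _≢_; refl; sym; trans; cong; module ≡-Reasoning)
open import Relation.Binary.Construct.Closure.ReflexiveTransitive using (Star; ε; _◅_)

-- Two cops start on an edge xy. By 2P₂-freeness every neighbour of a robber r
-- away from x and y lies in N(x) ∪ N(y). If one of N(x), N(y) contains all of
-- N(r), the cops trap r in one round. Otherwise r has a neighbour s adjacent
-- to y only and a neighbour s' adjacent to x only. The cops move to x and s,
-- driving r to a neighbour t on the y-side, and then to y and s. The house
-- forbids edges from s' to s, to t and to the y-side neighbours of r, and then
-- every escape u from t spans an induced 2P₂ or a house.

TwinFree : Graph → Set
TwinFree H = ∀ i j → (∀ k → adj H i k ≡ adj H j k) → i ≡ j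

twinFree? : ∀ H → Dec (TwinFree H)
twinFree? H = all? λ i → all? λ j → all? (λ k → adj H i k ≟ᵇ adj H j k) →-dec i ≟ j

2P₂-twinFree : TwinFree 2P₂
2P₂-twinFree = from-yes (twinFree? 2P₂)

house-twinFree : TwinFree house
house-twinFree = from-yes (twinFree? house)

-- An adjacency-preserving map out of a twin-free graph is automatically injective.
twinFree⇒induced : ∀ {H G} → TwinFree H → (f : V H → V G) →
                   (∀ i j → adj G (f i) (f j) ≡ adj H i j) → Contains G H
twinFree⇒induced {H} {G} twinFree f pres = f , injective , λ i j → sym (pres i j)
  where
  open ≡-Reasoning
  injective : ∀ {i j} → f i ≡ f j → i ≡ j
  injective {i} {j} fi≡fj = twinFree i j λ k → begin
    adj H i k         ≡⟨ sym (pres i k) ⟩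
    adj G (f i) (f k) ≡⟨ cong (λ v → adj G v (f k)) fi≡fj ⟩
    adj G (f j) (f k) ≡⟨ pres j k ⟩
    adj H j k         ∎

module Adjacency (G : Graph) where

  infix 4 _~_ _≁_

  _~_ : V G → V G → Set
  u ~ v = adj G u v ≡ true

  _≁_ : V G → V G → Set
  u ≁ v = adj G u v ≡ false

  ≁⇒¬~ : ∀ {u v} → u ≁ v → ¬ u ~ v
  ≁⇒¬~ u≁v u~v with () ← trans (sym u≁v) u~v

  adjacent? : ∀ u v → u ~ v ⊎ u ≁ v
  adjacent? u v with adj G u v
  ... | true  = inj₁ refl
  ... | false = inj₂ refl

  neighbours⊆N[_]? : ∀ a r → (∀ t → r ~ t → a ~ t) ⊎ ∃[ t ] r ~ t × a ≁ t
  neighbours⊆N[ a ]? r with any? (λ t → (adj G r t ≟ᵇ true) ×-dec (adj G a t ≟ᵇ false))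
  ... | yes escape  = inj₂ escape
  ... | no ¬escape = inj₁ λ t r~t →
    [ id , (λ a≁t → ⊥-elim (¬escape (t , r~t , a≁t))) ]′ (adjacent? a t)

  walk⇒neighbour : ∀ {u v} → Star (Adj G) u v → u ≢ v → ∃[ w ] u ~ w
  walk⇒neighbour ε         u≢u = ⊥-elim (u≢u refl)
  walk⇒neighbour (u~w ◅ _) _   = _ , u~w

module SimpleGraph {G : Graph} (simple : IsSimple G) where

  open Adjacency G

  adj-swap : ∀ {u v b} → adj G u v ≡ b → adj G v u ≡ b
  adj-swap {u} {v} e = trans (proj₁ simple v u) e

  irr : ∀ u → u ≁ u
  irr = proj₂ simple

  2P₂-induced : ∀ {a b c d} → a ~ b → c ~ d →
                a ≁ c → a ≁ d → b ≁ c → b ≁ d → Contains G 2P₂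
  2P₂-induced {a} {b} {c} {d} ab cd ac ad bc bd =
    twinFree⇒induced {G = G} 2P₂-twinFree f pres
    where
    f : Fin 4 → V G
    f zero                   = a
    f (suc zero)             = b
    f (suc (suc zero))       = c
    f (suc (suc (suc zero))) = d
    pres : ∀ i j → adj G (f i) (f j) ≡ adj 2P₂ i j
    pres zero                   zero                   = irr a
    pres zero                   (suc zero)             = ab
    pres zero                   (suc (suc zero))       = ac
    pres zero                   (suc (suc (suc zero))) = ad
    pres (suc zero)             zero                   = adj-swap ab
    pres (suc zero)             (suc zero)             = irr b
    pres (suc zero)             (suc (suc zero))       = bc
    pres (suc zero)             (suc (suc (suc zero))) = bd
    pres (suc (suc zero))       zero                   = adj-swap ac
    pres (suc (suc zero))       (suc zero)             = adj-swap bc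
    pres (suc (suc zero))       (suc (suc zero))       = irr c
    pres (suc (suc zero))       (suc (suc (suc zero))) = cd
    pres (suc (suc (suc zero))) zero                   = adj-swap ad
    pres (suc (suc (suc zero))) (suc zero)             = adj-swap bd
    pres (suc (suc (suc zero))) (suc (suc zero))       = adj-swap cd
    pres (suc (suc (suc zero))) (suc (suc (suc zero))) = irr d

  -- The 4-cycle w x y z with the roof h over the edge w x; the path
  -- 0-1-2-3-4 of the complement is w-y-h-z-x.
  house-induced : ∀ {w x y z h} → w ~ x → x ~ y → y ~ z → z ~ w → h ~ w → h ~ x →
                  w ≁ y → x ≁ z → h ≁ y → h ≁ z → Contains G house
  house-induced {w} {x} {y} {z} {h} wx xy yz zw hw hx wy xz hy hz =
    twinFree⇒induced {G = G} house-twinFree f pres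
    where
    f : Fin 5 → V G
    f zero                         = w
    f (suc zero)                   = y
    f (suc (suc zero))             = h
    f (suc (suc (suc zero)))       = z
    f (suc (suc (suc (suc zero)))) = x
    pres : ∀ i j → adj G (f i) (f j) ≡ adj house i j
    pres zero                         zero                         = irr w
    pres zero                         (suc zero)                   = wy
    pres zero                         (suc (suc zero))             = adj-swap hw
    pres zero                         (suc (suc (suc zero)))       = adj-swap zw
    pres zero                         (suc (suc (suc (suc zero)))) = wx
    pres (suc zero)                   zero                         = adj-swap wy
    pres (suc zero)                   (suc zero)                   = irr y
    pres (suc zero)                   (suc (suc zero))             = adj-swap hy
    pres (suc zero)                   (suc (suc (suc zero)))       = yz
    pres (suc zero)                   (suc (suc (suc (suc zero)))) = adj-swap xy
    pres (suc (suc zero))             zero                         = hw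
    pres (suc (suc zero))             (suc zero)                   = hy
    pres (suc (suc zero))             (suc (suc zero))             = irr h
    pres (suc (suc zero))             (suc (suc (suc zero)))       = hz
    pres (suc (suc zero))             (suc (suc (suc (suc zero)))) = hx
    pres (suc (suc (suc zero)))       zero                         = zw
    pres (suc (suc (suc zero)))       (suc zero)                   = adj-swap yz
    pres (suc (suc (suc zero)))       (suc (suc zero))             = adj-swap hz
    pres (suc (suc (suc zero)))       (suc (suc (suc zero)))       = irr z
    pres (suc (suc (suc zero)))       (suc (suc (suc (suc zero)))) = adj-swap xz
    pres (suc (suc (suc (suc zero)))) zero                         = adj-swap wx
    pres (suc (suc (suc (suc zero)))) (suc zero)                   = xy
    pres (suc (suc (suc (suc zero)))) (suc (suc zero))             = adj-swap hx
    pres (suc (suc (suc (suc zero)))) (suc (suc (suc zero)))       = xz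
    pres (suc (suc (suc (suc zero)))) (suc (suc (suc (suc zero)))) = irr x

module Free2P₂House {G : Graph} (simple : IsSimple G)
                    (no2P₂ : ¬ Contains G 2P₂) (noHouse : ¬ Contains G house) where

  open Adjacency G
  open SimpleGraph simple

  module AwayFromEdge {x y r} (xy : x ~ y) (x≁r : x ≁ r) (y≁r : y ≁ r) where

    neighbour-dominated : ∀ {t} → r ~ t → x ~ t ⊎ y ~ t
    neighbour-dominated {t} rt with adjacent? x t | adjacent? y t
    ... | inj₁ xt  | _        = inj₁ xt
    ... | inj₂ _   | inj₁ yt  = inj₂ yt
    ... | inj₂ x≁t | inj₂ y≁t = ⊥-elim (no2P₂ (2P₂-induced xy rt x≁r x≁t y≁r y≁t))

    y-side : ∀ {t} → r ~ t → x ≁ t → y ~ t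
    y-side rt x≁t = [ (λ xt → ⊥-elim (≁⇒¬~ x≁t xt)) , id ]′ (neighbour-dominated rt)

    x-side : ∀ {t} → r ~ t → y ≁ t → x ~ t
    x-side rt y≁t = [ id , (λ yt → ⊥-elim (≁⇒¬~ y≁t yt)) ]′ (neighbour-dominated rt)

    y-side≁x-side : ∀ {z w} → r ~ z → y ~ z → x ≁ z → r ~ w → x ~ w → y ≁ w → z ≁ w
    y-side≁x-side {z} {w} rz yz x≁z rw xw y≁w with adjacent? z w
    ... | inj₂ z≁w = z≁w
    ... | inj₁ zw  = ⊥-elim (noHouse (house-induced zw (adj-swap xw) xy yz rz rw
                                       (adj-swap x≁z) (adj-swap y≁w) (adj-swap x≁r) (adj-swap y≁r)))

    y-side-escape-impossible :
      ∀ {s s' t u} → r ~ s → y ~ s → x ≁ s → r ~ s' → x ~ s' → y ≁ s' →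
      r ~ t → y ~ t → x ≁ t → t ~ u → y ≁ u → s ≁ u → ⊥
    y-side-escape-impossible {s} {s'} {t} {u} rs ys x≁s rs' xs' y≁s' rt yt x≁t tu y≁u s≁u
      with adjacent? s' u
    ... | inj₁ s'u  = no2P₂ (2P₂-induced ys (adj-swap s'u) y≁u y≁s' s≁u s≁s')
      where
      s≁s' : s ≁ s'
      s≁s' = y-side≁x-side rs ys x≁s rs' xs' y≁s'
    ... | inj₂ s'≁u with adjacent? x u
    ...   | inj₂ x≁u = no2P₂ (2P₂-induced (adj-swap tu) xs' (adj-swap x≁u) (adj-swap s'≁u)
                                            (adj-swap x≁t) t≁s')
      where
      t≁s' : t ≁ s'
      t≁s' = y-side≁x-side rt yt x≁t rs' xs' y≁s'
    ...   | inj₁ xu with adjacent? r u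
    ...     | inj₁ ru  = ≁⇒¬~ (y-side≁x-side rt yt x≁t ru xu y≁u) tu
    ...     | inj₂ r≁u = no2P₂ (2P₂-induced (adj-swap rs) xu (adj-swap x≁s) s≁u (adj-swap x≁r) r≁u)

module TwoCopPursuit {G : Graph} (simple : IsSimple G) (connected : Connected G)
                     (no2P₂ : ¬ Contains G 2P₂) (noHouse : ¬ Contains G house) where

  open Adjacency G
  open SimpleGraph simple using (adj-swap)
  open Free2P₂House simple no2P₂ noHouse

  cops : V G → V G → Fin 2 → V G
  cops a b zero       = a
  cops a b (suc zero) = b

  Win : V G → V G → V G → Set
  Win a b r = CopWin G (cops a b) r

  cops-step : ∀ {a b a' b'} → Step G a a' → Step G b b' → ∀ i → Step G (cops a b i) (cops a' b' i)
  cops-step sa sb zero       = sa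
  cops-step sa sb (suc zero) = sb

  respond : ∀ {a b a' b' r} → Step G a a' → Step G b b' →
            (∀ r' → Step G r r' → Win a' b' r') → Win a b r
  respond sa sb next = move _ (cops-step sa sb) (inj₂ next)

  catch-next : ∀ {a b r} → a ~ r ⊎ b ~ r → Win a b r
  catch-next (inj₁ ar) = move _ (cops-step (inj₂ ar) (inj₁ refl)) (inj₁ (zero , refl))
  catch-next (inj₂ br) = move _ (cops-step (inj₁ refl) (inj₂ br)) (inj₁ (suc zero , refl))

  trap : ∀ {a b a' b' r} → Step G a a' → Step G b b' →
         (∀ r' → Step G r r' → a' ~ r' ⊎ b' ~ r') → Win a b r
  trap sa sb cornered = respond sa sb λ r' st → catch-next (cornered r' st)

  catch-unless-far : ∀ {a b r} → (a ≁ r → b ≁ r → Win a b r) → Win a b r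
  catch-unless-far {a} {b} {r} far with adjacent? a r | adjacent? b r
  ... | inj₁ ar  | _        = catch-next (inj₁ ar)
  ... | inj₂ _   | inj₁ br  = catch-next (inj₂ br)
  ... | inj₂ a≁r | inj₂ b≁r = far a≁r b≁r

  module OnEdge {x y} (xy : x ~ y) where

    module AwayRobber {r} (x≁r : x ≁ r) (y≁r : y ≁ r) where

      open AwayFromEdge xy x≁r y≁r

      r≢x : r ≢ x
      r≢x refl = ≁⇒¬~ y≁r (adj-swap xy)

      neighbours⊆N[x] : ∀ {s} → r ~ s → (∀ t → r ~ t → x ~ t) → Win x y r
      neighbours⊆N[x] {s} rs N[r]⊆N[x] = trap (inj₂ (N[r]⊆N[x] s rs)) (inj₂ (adj-swap xy)) λ where
        _ (inj₁ refl) → inj₁ (adj-swap rs)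
        t (inj₂ rt)   → inj₂ (N[r]⊆N[x] t rt)

      neighbours⊆N[y] : ∀ {s} → r ~ s → (∀ t → r ~ t → y ~ t) → Win x y r
      neighbours⊆N[y] {s} rs N[r]⊆N[y] = trap (inj₂ xy) (inj₂ (N[r]⊆N[y] s rs)) λ where
        _ (inj₁ refl) → inj₂ (adj-swap rs)
        t (inj₂ rt)   → inj₁ (N[r]⊆N[y] t rt)

      neighbours-split : ∀ {s s'} → r ~ s → x ≁ s → r ~ s' → y ≁ s' → Win x y r
      neighbours-split {s} rs x≁s rs' y≁s' = respond (inj₁ refl) (inj₂ ys) λ where
          _ (inj₁ refl) → catch-next (inj₂ (adj-swap rs))
          t (inj₂ rt)   → catch-unless-far λ x≁t _ → from-y-side rt (y-side rt x≁t) x≁t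
        where
        ys : y ~ s
        ys = y-side rs x≁s
        from-y-side : ∀ {t} → r ~ t → y ~ t → x ≁ t → Win x s t
        from-y-side rt yt x≁t = respond (inj₂ xy) (inj₁ refl) λ where
          _ (inj₁ refl) → catch-next (inj₁ yt)
          u (inj₂ tu)   → catch-unless-far λ y≁u s≁u → ⊥-elim
            (y-side-escape-impossible rs ys x≁s rs' (x-side rs' y≁s') y≁s' rt yt x≁t tu y≁u s≁u)

      away-robber-caught : Win x y r
      away-robber-caught with neighbours⊆N[ x ]? r
      ... | inj₁ N[r]⊆N[x] = neighbours⊆N[x] (proj₂ (walk⇒neighbour (proj₂ connected r x) r≢x)) N[r]⊆N[x]
      ... | inj₂ (s , rs , x≁s) with neighbours⊆N[ y ]? r
      ...   | inj₁ N[r]⊆N[y]       = neighbours⊆N[y] rs N[r]⊆N[y]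
      ...   | inj₂ (_ , rs' , y≁s') = neighbours-split rs x≁s rs' y≁s'

    cops-on-edge-win : ∀ r → Win x y r
    cops-on-edge-win r = catch-unless-far (AwayRobber.away-robber-caught {r})

  x₀ : V G
  x₀ = fromℕ< (proj₁ connected)

  two-cops-win : CopsWin G 2
  two-cops-win with any? (λ y → adj G x₀ y ≟ᵇ true)
  ... | yes (y , x₀y) = cops _ y , OnEdge.cops-on-edge-win x₀y
  ... | no isolated  = cops x₀ x₀ , λ r → only-x₀ (proj₂ connected x₀ r)
    where
    only-x₀ : ∀ {r} → Star (Adj G) x₀ r → Win x₀ x₀ r
    only-x₀ ε       = caught (zero , refl)
    only-x₀ (e ◅ _) = ⊥-elim (isolated (_ , e))

theorem5 : (G : Graph) → IsSimple G → Connected G →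
           ¬ Contains G 2P₂ → ¬ Contains G house →
           CopNumber≤ G 2
theorem5 G simple connected no2P₂ noHouse =
  2 , ≤-refl , TwoCopPursuit.two-cops-win simple connected no2P₂ noHouse
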